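{- Let $V\in\Sigma_\$^+$. Let $j=\mathrm{select}_\$(V,1)-1$ if $\$$ occurs in $V$, and $j=|V|$ otherwise. Then $\sum_{i=1}^{j}\mathrm{RTS}(V)[i]\le|V|$.
   Context: $\Sigma=[0..\sigma]$ integer alphabet, $\$\notin\Sigma$ a symbol smaller than every integer, $\Sigma_\$=\Sigma\cup\{\$\}$, $\infty$ a symbol larger than every integer. Strings are 1-indexed; $X[i..]=X[i..|X|]$. $\mathrm{select}_\$(V,1)$ is the position of the first occurrence of $\$$ in $V$; $\mathrm{rank}_c(X,j)$ is the number of occurrences of $c$ in $X[1..j]$. $\mathrm{rot}^0(X)=X$, $\mathrm{rot}^{k+1}(X)=\mathrm{rot}^k(X)[2..]\cdot\mathrm{rot}^k(X)[1]$. $\mathrm{PD}(V)[i]=\infty$ if $V[i]\neq\$$ and $V[i]<V[j]$ for all $j<i$; $=\$$ if $V[i]=\$$; otherwise $i-\max\{j<i:V[j]\le V[i]\}$. Rotational Cartesian tree signature encoding: $\mathrm{RTS}(V)$ has length $|V|$, $\mathrm{RTS}(V)[i]=\$$ if $V[i]=\$$, and otherwise $\mathrm{RTS}(V)[i]=\mathrm{rank}_\infty(\mathrm{PD}(\mathrm{rot}^i(V)),|V|)-\mathrm{rank}_\infty(\mathrm{PD}(V[i]\cdot\mathrm{rot}^i(V))[2..],|V|)$ (a nonnegative integer). -}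

module Defs where

open import Data.Nat using (ℕ; zero; suc; _≤_; _≤ᵇ_)
open import Data.Bool using (Bool; true; false; if_then_else_)
open import Data.Maybe using (Maybe; just; nothing)
open import Data.List using (List; []; _∷_; _++_; [_]; length; drop; take; foldr)
open import Data.Unit using (⊤)
open import Data.Integer as ℤ using (ℤ; +_; _-_)

-- Σ_$ symbols: `nothing` is $, `just a` is the integer a.
Sym : Set
Sym = Maybe ℕ

_≤ₛ_ : Sym → Sym → Bool
nothing ≤ₛ _ = true
just _ ≤ₛ nothing = false
just a ≤ₛ just b = a ≤ᵇ b

isDollar : Sym → Bool
isDollar nothing = true
isDollar (just _) = false

data PDSym : Set where
  inf    : PDSym
  dollar : PDSym
  dist   : ℕ → PDSym

-- scan the earlier characters (nearest first, at distance d) for the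
-- nearest j < i with V[j] ≤ V[i]; if none, V[i] < V[j] for all j < i, so ∞
scanBack : ℕ → List Sym → Sym → PDSym
scanBack d [] x = inf
scanBack d (y ∷ ys) x = if y ≤ₛ x then dist d else scanBack (suc d) ys x

pdEntry : List Sym → Sym → PDSym
pdEntry prevRev nothing  = dollar
pdEntry prevRev (just a) = scanBack 1 prevRev (just a)

pdGo : List Sym → List Sym → List PDSym
pdGo prevRev [] = []
pdGo prevRev (x ∷ xs) = pdEntry prevRev x ∷ pdGo (x ∷ prevRev) xs

PD : List Sym → List PDSym
PD = pdGo []

countInf : List PDSym → ℕ
countInf [] = 0
countInf (inf ∷ xs) = suc (countInf xs)
countInf (dollar ∷ xs) = countInf xs
countInf (dist _ ∷ xs) = countInf xs

rankInf : List PDSym → ℕ → ℕ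
rankInf X j = countInf (take j X)

rot : List Sym → List Sym
rot [] = []
rot (x ∷ xs) = xs ++ [ x ]

rotN : ℕ → List Sym → List Sym
rotN zero X = X
rotN (suc k) X = rot (rotN k X)

rtsGo : List Sym → ℕ → List Sym → List (Maybe ℤ)
rtsGo V i [] = []
rtsGo V i (nothing ∷ xs) = nothing ∷ rtsGo V (suc i) xs
rtsGo V i (just a ∷ xs) =
  just ((+ rankInf (PD (rotN i V)) (length V))
        - (+ rankInf (drop 1 (PD (just a ∷ rotN i V))) (length V)))
  ∷ rtsGo V (suc i) xs

RTS : List Sym → List (Maybe ℤ)
RTS V = rtsGo V 1 V

dollarPrefixLen : List Sym → ℕ
dollarPrefixLen [] = 0
dollarPrefixLen (nothing ∷ xs) = 0
dollarPrefixLen (just _ ∷ xs) = suc (dollarPrefixLen xs)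

-- sum of the integer entries of an RTS prefix ($ entries never occur in
-- the prefix considered; they would contribute 0)
sumRTS : List (Maybe ℤ) → ℤ
sumRTS [] = + 0
sumRTS (nothing ∷ xs) = sumRTS xs
sumRTS (just n ∷ xs) = n ℤ.+ sumRTS xs

InAlphabet : ℕ → Sym → Set
InAlphabet σ nothing = ⊤
InAlphabet σ (just a) = a ≤ σ

{-# OPTIONS --safe #-}
-- PD(X)[k] = ∞ exactly when X[k] is a strict prefix minimum of X (a $ blocks all later
-- ones). Prepending a to X removes exactly the prefix minima below a, so for V[i] = a
-- the entry RTS(V)[i] counts the prefix minima of rot^i(V) that are ≥ a. Read V
-- cyclically: such a prefix minimum at position q says that i is the nearest position
-- before q whose value is ≤ V[q]. Every q has at most one such nearest predecessor, so
-- over all i each residue q mod |V| is counted at most once.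
module Submission where

open import Defs
open import Data.Nat using (ℕ)
open import Data.List using (List; []; take; length)
open import Data.List.Relation.Unary.All using (All)
open import Relation.Binary.PropositionalEquality using (_≢_)

module RTSBound where

  open import Algebra.Properties.CommutativeSemigroup using (interchange)
  open import Data.Bool using (Bool; true; false; not; _∧_; T)
  open import Data.Bool.Properties using (∧-assoc; ∧-zeroʳ; ∧-identityʳ; T-∧; T-not-≡)
  open import Data.Empty using (⊥; ⊥-elim)
  open import Data.Integer as ℤ using (ℤ; +_; _-_; +≤+; _⊖_)
  import Data.Integer.Properties as ℤₚ
  open import Data.List using (_∷_; _++_; [_]; drop)
  open import Data.List.Properties using (length-++; take-all)
  open import Data.Maybe using (just; nothing; maybe′)
  open import Data.Maybe.Properties using (just-injective)
  open import Data.Nat using (zero; suc; _+_; _∸_; _≤_; _<_; _≤ᵇ_; z≤n; s≤s; z<s; s<s; _<?_)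
  open import Data.Nat.Properties
    using ( ≤-refl; ≤-reflexive; ≤-trans; <-trans; ≤-<-trans; <-≤-trans; <⇒≤; <-irrefl
          ; ≮⇒≥; ≤⇒≯; n<1+n; m≤m+n; +-comm; +-assoc; +-suc; +-identityʳ; +-mono-≤
          ; +-monoʳ-<; +-cancelˡ-<; m+[n∸m]≡n; m∸n+n≡m; m+n∸m≡n; m≤n⇒∃[o]m+o≡n
          ; ≤⇒≤ᵇ; ≤ᵇ⇒≤; +-commutativeSemigroup )
  open import Data.Product using (_×_; _,_; proj₁; proj₂)
  open import Data.Sum using (_⊎_; inj₁; inj₂)
  open import Function using (_∘_)
  open import Function.Bundles using (Equivalence)
  open import Relation.Binary.PropositionalEquality
    using (_≡_; refl; sym; trans; cong; cong₂; subst; module ≡-Reasoning)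
  open import Relation.Nullary using (¬_; yes; no; contradiction)

  ∑ : ℕ → (ℕ → ℕ) → ℕ
  ∑ zero    f = 0
  ∑ (suc n) f = f 0 + ∑ n (λ k → f (suc k))

  syntax ∑ n (λ k → e) = ∑[ k < n ] e

  ∑-cong : ∀ {f g} n → (∀ {k} → k < n → f k ≡ g k) → ∑ n f ≡ ∑ n g
  ∑-cong zero    _   = refl
  ∑-cong (suc n) f≗g = cong₂ _+_ (f≗g z<s) (∑-cong n (λ k<n → f≗g (s<s k<n)))

  ∑-mono : ∀ {f g} n → (∀ {k} → k < n → f k ≤ g k) → ∑ n f ≤ ∑ n g
  ∑-mono zero    _   = z≤n
  ∑-mono (suc n) f≤g = +-mono-≤ (f≤g z<s) (∑-mono n (λ k<n → f≤g (s<s k<n)))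

  ∑-0 : ∀ n → ∑[ k < n ] 0 ≡ 0
  ∑-0 zero    = refl
  ∑-0 (suc n) = ∑-0 n

  ∑-1 : ∀ n → ∑[ k < n ] 1 ≡ n
  ∑-1 zero    = refl
  ∑-1 (suc n) = cong suc (∑-1 n)

  ∑-split : ∀ m n f → ∑ (m + n) f ≡ ∑ m f + ∑[ k < n ] f (m + k)
  ∑-split zero    n f = refl
  ∑-split (suc m) n f =
    trans (cong (λ x → f 0 + x) (∑-split m n (λ k → f (suc k)))) (sym (+-assoc (f 0) _ _))

  ∑-distrib-+ : ∀ n f g → ∑[ k < n ] (f k + g k) ≡ ∑ n f + ∑ n g
  ∑-distrib-+ zero    f g = refl
  ∑-distrib-+ (suc n) f g =
    trans (cong (λ x → f 0 + g 0 + x) (∑-distrib-+ n _ _))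
          (interchange +-commutativeSemigroup (f 0) (g 0) _ _)

  ∑-comm : ∀ m n (f : ℕ → ℕ → ℕ) →
           ∑[ i < m ] ∑[ j < n ] f i j ≡ ∑[ j < n ] ∑[ i < m ] f i j
  ∑-comm zero    n f = sym (∑-0 n)
  ∑-comm (suc m) n f =
    trans (cong (λ x → ∑ n (f 0) + x) (∑-comm m n (λ i → f (suc i))))
          (sym (∑-distrib-+ n (f 0) _))

  -- (p − s) mod n, for s ≤ n and p < n
  cyclicOffset : ℕ → ℕ → ℕ → ℕ
  cyclicOffset n s p with p <? s
  ... | yes _ = n ∸ s + p
  ... | no  _ = p ∸ s

  cyclicOffset-< : ∀ {n s p} → p < s → cyclicOffset n s p ≡ n ∸ s + p
  cyclicOffset-< {n} {s} {p} p<s with p <? s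
  ... | yes _   = refl
  ... | no  p≮s = contradiction p<s p≮s

  cyclicOffset-≥ : ∀ {n s p} → s ≤ p → cyclicOffset n s p ≡ p ∸ s
  cyclicOffset-≥ {n} {s} {p} s≤p with p <? s
  ... | yes p<s = contradiction p<s (≤⇒≯ s≤p)
  ... | no  _   = refl

  ∑-rotate : ∀ {n s} f → s ≤ n → ∑[ k < n ] f k ≡ ∑[ p < n ] f (cyclicOffset n s p)
  ∑-rotate {n} {s} f s≤n = begin
    ∑ n f
      ≡⟨ cong (λ m → ∑ m f) (sym (m∸n+n≡m s≤n)) ⟩
    ∑ (n ∸ s + s) f
      ≡⟨ ∑-split (n ∸ s) s f ⟩
    ∑ (n ∸ s) f + ∑[ p < s ] f (n ∸ s + p)
      ≡⟨ +-comm (∑ (n ∸ s) f) _ ⟩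
    ∑[ p < s ] f (n ∸ s + p) + ∑ (n ∸ s) f
      ≡⟨ cong₂ _+_ (∑-cong s wraps) (∑-cong (n ∸ s) stays) ⟩
    ∑[ p < s ] g p + ∑[ p < n ∸ s ] g (s + p)
      ≡⟨ sym (∑-split s (n ∸ s) g) ⟩
    ∑ (s + (n ∸ s)) g
      ≡⟨ cong (λ m → ∑ m g) (m+[n∸m]≡n s≤n) ⟩
    ∑ n g ∎
    where
    open ≡-Reasoning
    g : ℕ → ℕ
    g p = f (cyclicOffset n s p)
    wraps : ∀ {p} → p < s → f (n ∸ s + p) ≡ g p
    wraps p<s = cong f (sym (cyclicOffset-< p<s))
    stays : ∀ {p} → p < n ∸ s → f p ≡ g (s + p)
    stays {p} _ = cong f (trans (sym (m+n∸m≡n s p)) (sym (cyclicOffset-≥ (m≤m+n s p))))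

  𝟙 : Bool → ℕ
  𝟙 true  = 1
  𝟙 false = 0

  count : ℕ → (ℕ → Bool) → ℕ
  count n β = ∑[ k < n ] 𝟙 (β k)

  count-≡0 : ∀ {β} n → (∀ {k} → k < n → ¬ T (β k)) → count n β ≡ 0
  count-≡0 zero _ = refl
  count-≡0 {β} (suc n) none with β 0 in β0
  ... | true  = contradiction (subst T (sym β0) _) (none z<s)
  ... | false = count-≡0 n (λ k<n → none (s<s k<n))

  count-≤1 : ∀ {β} n → (∀ {t t′} → t < t′ → t′ < n → T (β t) → T (β t′) → ⊥) →
             count n β ≤ 1
  count-≤1 zero _ = z≤n
  count-≤1 {β} (suc n) excl with β 0 in β0
  ... | false = count-≤1 n (λ t<t′ t′<n → excl (s<s t<t′) (s<s t′<n))
  ... | true  =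
    s≤s (≤-reflexive (count-≡0 n (λ k<n → excl z<s (s<s k<n) (subst T (sym β0) _))))

  -- Positions past the end read as $, which is never a prefix minimum.
  _‼_ : List Sym → ℕ → Sym
  []       ‼ _     = nothing
  (x ∷ xs) ‼ zero  = x
  (x ∷ xs) ‼ suc k = xs ‼ k

  ‼-just⇒< : ∀ xs {k a} → xs ‼ k ≡ just a → k < length xs
  ‼-just⇒< (x ∷ xs) {zero}  _  = z<s
  ‼-just⇒< (x ∷ xs) {suc k} eq = s<s (‼-just⇒< xs eq)

  above : ℕ → Sym → Bool
  above c y = not (y ≤ₛ just c)

  allAbove : ℕ → (ℕ → Sym) → ℕ → Bool
  allAbove c f zero    = true
  allAbove c f (suc k) = above c (f 0) ∧ allAbove c (λ j → f (suc j)) k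

  prefixMin : (ℕ → Bool) → (ℕ → Sym) → ℕ → Bool
  prefixMin p f k = maybe′ (λ c → p c ∧ allAbove c f k) false (f k)

  allAbove-sound : ∀ {c f} k → T (allAbove c f k) → ∀ {j} → j < k → T (above c (f j))
  allAbove-sound (suc k) h {zero}  _         = proj₁ (Equivalence.to T-∧ h)
  allAbove-sound (suc k) h {suc j} (s<s j<k) =
    allAbove-sound k (proj₂ (Equivalence.to T-∧ h)) j<k

  allAbove-cong : ∀ {c f g} k → (∀ {j} → j < k → f j ≡ g j) →
                  allAbove c f k ≡ allAbove c g k
  allAbove-cong zero        _   = refl
  allAbove-cong {c} (suc k) f≗g =
    cong₂ _∧_ (cong (above c) (f≗g z<s)) (allAbove-cong k (λ j<k → f≗g (s<s j<k)))

  prefixMin-cong : ∀ {p f g} k → (∀ {j} → j ≤ k → f j ≡ g j) →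
                   prefixMin p f k ≡ prefixMin p g k
  prefixMin-cong {p} {f} {g} k f≗g with f k | g k | f≗g (≤-refl {k})
  ... | nothing | .nothing  | refl = refl
  ... | just c  | .(just c) | refl =
    cong (p c ∧_) (allAbove-cong k (λ j<k → f≗g (<⇒≤ j<k)))

  isInf : PDSym → Bool
  isInf inf      = true
  isInf dollar   = false
  isInf (dist _) = false

  countInf-∷ : ∀ e es → countInf (e ∷ es) ≡ 𝟙 (isInf e) + countInf es
  countInf-∷ inf      es = refl
  countInf-∷ dollar   es = refl
  countInf-∷ (dist _) es = refl

  record InfAfter (R : List Sym) (P : ℕ → Bool) : Set where
    constructor infAfter
    field isInf-scanBack : ∀ d c → isInf (scanBack d R (just c)) ≡ P c

  InfAfter-[] : InfAfter [] (λ _ → true)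
  InfAfter-[] = infAfter (λ _ _ → refl)

  InfAfter-∷ : ∀ {R P} x → InfAfter R P → InfAfter (x ∷ R) (λ c → P c ∧ above c x)
  InfAfter-∷ {R} {P} x (infAfter infR) = infAfter step
    where
    step : ∀ d c → isInf (scanBack d (x ∷ R) (just c)) ≡ P c ∧ above c x
    step d c with x ≤ₛ just c
    ... | true  = sym (∧-zeroʳ _)
    ... | false = trans (infR (suc d) c) (sym (∧-identityʳ _))

  isInf-pdEntry : ∀ {R P} x Y → InfAfter R P →
                  isInf (pdEntry R x) ≡ prefixMin P ((x ∷ Y) ‼_) 0
  isInf-pdEntry nothing  Y _               = refl
  isInf-pdEntry (just c) Y (infAfter infR) = trans (infR 1 c) (sym (∧-identityʳ _))

  countInf-pdGo : ∀ {R P} Y m → InfAfter R P → length Y ≤ m →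
                  countInf (pdGo R Y) ≡ count m (prefixMin P (Y ‼_))
  countInf-pdGo []      m _ _ = sym (∑-0 m)
  countInf-pdGo {R} {P} (x ∷ Y) (suc m) infR (s≤s |Y|≤m) = begin
    countInf (pdEntry R x ∷ pdGo (x ∷ R) Y)
      ≡⟨ countInf-∷ (pdEntry R x) _ ⟩
    𝟙 (isInf (pdEntry R x)) + countInf (pdGo (x ∷ R) Y)
      ≡⟨ cong₂ _+_ (cong 𝟙 (isInf-pdEntry x Y infR))
                   (countInf-pdGo Y m (InfAfter-∷ x infR) |Y|≤m) ⟩
    𝟙 (prefixMin P ((x ∷ Y) ‼_) 0) + count m (prefixMin (λ c → P c ∧ above c x) (Y ‼_))
      ≡⟨ cong (λ x → _ + x) (∑-cong m (λ {k} _ → cong 𝟙 (rest k))) ⟩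
    count (suc m) (prefixMin P ((x ∷ Y) ‼_)) ∎
    where
    open ≡-Reasoning
    rest : ∀ k →
           prefixMin (λ c → P c ∧ above c x) (Y ‼_) k ≡ prefixMin P ((x ∷ Y) ‼_) (suc k)
    rest k with Y ‼ k
    ... | nothing = refl
    ... | just c  = ∧-assoc (P c) (above c x) _

  prefixMin-split : ∀ q f k → 𝟙 (prefixMin (λ _ → true) f k)
                              ≡ 𝟙 (prefixMin (λ c → not (q c)) f k) + 𝟙 (prefixMin q f k)
  prefixMin-split q f k with f k
  ... | nothing = refl
  ... | just c with q c
  ...   | true  = refl
  ...   | false = sym (+-identityʳ _)

  countInf-PD : ∀ a Y m → length Y ≤ m → countInf (PD Y)
                ≡ countInf (pdGo [ just a ] Y) + count m (prefixMin (a ≤ᵇ_) (Y ‼_))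
  countInf-PD a Y m |Y|≤m = begin
    countInf (PD Y)
      ≡⟨ countInf-pdGo Y m InfAfter-[] |Y|≤m ⟩
    count m (prefixMin (λ _ → true) (Y ‼_))
      ≡⟨ ∑-cong m (λ {k} _ → prefixMin-split (a ≤ᵇ_) (Y ‼_) k) ⟩
    ∑[ k < m ] (𝟙 (below k) + 𝟙 (atLeast k))
      ≡⟨ ∑-distrib-+ m _ _ ⟩
    count m below + count m atLeast
      ≡⟨ cong (λ x → x + count m atLeast) (sym below-count) ⟩
    countInf (pdGo [ just a ] Y) + count m atLeast ∎
    where
    open ≡-Reasoning
    below atLeast : ℕ → Bool
    below   = prefixMin (λ c → above c (just a)) (Y ‼_)
    atLeast = prefixMin (a ≤ᵇ_) (Y ‼_)
    below-count : countInf (pdGo [ just a ] Y) ≡ count m below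
    below-count = countInf-pdGo Y m (InfAfter-∷ (just a) InfAfter-[]) |Y|≤m

  length-rot : ∀ xs → length (rot xs) ≡ length xs
  length-rot []       = refl
  length-rot (x ∷ xs) = trans (length-++ xs) (+-comm (length xs) 1)

  length-rotN : ∀ s V → length (rotN s V) ≡ length V
  length-rotN zero    V = refl
  length-rotN (suc s) V = trans (length-rot (rotN s V)) (length-rotN s V)

  ‼-++ˡ : ∀ xs {ys k} → k < length xs → (xs ++ ys) ‼ k ≡ xs ‼ k
  ‼-++ˡ (x ∷ xs) {k = zero}  _         = refl
  ‼-++ˡ (x ∷ xs) {k = suc k} (s<s k<n) = ‼-++ˡ xs k<n

  rot-‼ : ∀ xs {k} → suc k < length xs → rot xs ‼ k ≡ xs ‼ suc k
  rot-‼ (x ∷ xs) (s<s k<n) = ‼-++ˡ xs k<n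

  rot-‼-last : ∀ xs {k} → suc k ≡ length xs → rot xs ‼ k ≡ xs ‼ 0
  rot-‼-last (x ∷ xs) refl = last xs
    where
    last : ∀ ys → (ys ++ [ x ]) ‼ length ys ≡ x
    last []       = refl
    last (y ∷ ys) = last ys

  -- cyclic V i = V[i mod |V|]
  cyclic : List Sym → ℕ → Sym
  cyclic V i = rotN i V ‼ 0

  rotN-‼ : ∀ {V} s {k} → k < length V → rotN s V ‼ k ≡ cyclic V (s + k)
  rotN-‼ {V} s {zero}  _   = cong (cyclic V) (sym (+-identityʳ s))
  rotN-‼ {V} s {suc k} k<n = begin
    rotN s V ‼ suc k     ≡⟨ sym (rot-‼ (rotN s V) 1+k<|rotN|) ⟩
    rotN (suc s) V ‼ k   ≡⟨ rotN-‼ (suc s) (<-trans (n<1+n k) k<n) ⟩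
    cyclic V (suc s + k) ≡⟨ cong (cyclic V) (sym (+-suc s k)) ⟩
    cyclic V (s + suc k) ∎
    where
    open ≡-Reasoning
    1+k<|rotN| : suc k < length (rotN s V)
    1+k<|rotN| = subst (suc k <_) (sym (length-rotN s V)) k<n

  cyclic-periodic : ∀ V r → cyclic V (length V + r) ≡ cyclic V r
  cyclic-periodic []         r = refl
  cyclic-periodic V@(x ∷ xs) r = begin
    cyclic V (suc (length xs + r)) ≡⟨ cong (cyclic V ∘ suc) (+-comm (length xs) r) ⟩
    cyclic V (suc r + length xs)   ≡⟨ sym (rotN-‼ (suc r) (n<1+n (length xs))) ⟩
    rot (rotN r V) ‼ length xs     ≡⟨ rot-‼-last (rotN r V) (sym (length-rotN r V)) ⟩
    cyclic V r                     ∎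
    where open ≡-Reasoning

  record NearestLeq (w : ℕ → Sym) (t q : ℕ) : Set where
    constructor nearestLeq
    field
      a c     : ℕ
      w[t]    : w t ≡ just a
      w[q]    : w q ≡ just c
      a≤c     : a ≤ c
      t<q     : t < q
      between : ∀ {r} → t < r → r < q → T (above c (w r))

  NearestLeq-unique : ∀ {w t t′ q} → NearestLeq w t q → NearestLeq w t′ q → t < t′ → ⊥
  NearestLeq-unique nl nl′ t<t′ =
    subst T (Equivalence.to T-not-≡ a′-above-c) (≤⇒≤ᵇ a′≤c)
    where
    open NearestLeq nl using (c; w[q]; between)
    open NearestLeq nl′ using ()
      renaming (a to a′; w[t] to w[t′]; w[q] to w[q]′; a≤c to a′≤c′; t<q to t′<q)
    a′≤c : a′ ≤ c
    a′≤c = subst (a′ ≤_) (just-injective (trans (sym w[q]′) w[q])) a′≤c′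
    a′-above-c : T (above c (just a′))
    a′-above-c = subst (T ∘ above c) w[t′] (between t<t′ t′<q)

  NearestLeq-shift : ∀ {w t q} n → (∀ r → w (n + r) ≡ w r) →
                     NearestLeq w t q → NearestLeq w (n + t) (n + q)
  NearestLeq-shift {w} {t} {q} n periodic (nearestLeq a c w[t] w[q] a≤c t<q between) =
    nearestLeq a c (trans (periodic t) w[t]) (trans (periodic q) w[q]) a≤c
               (+-monoʳ-< n t<q) between′
    where
    between′ : ∀ {r} → n + t < r → r < n + q → T (above c (w r))
    between′ {r} n+t<r r<n+q with m≤n⇒∃[o]m+o≡n (≤-trans (m≤m+n n t) (<⇒≤ n+t<r))
    ... | o , refl = subst (T ∘ above c) (sym (periodic o))
                       (between (+-cancelˡ-< n t o n+t<r) (+-cancelˡ-< n o q r<n+q))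

  -- tests NearestLeq w t (suc t + k): the position is given by its offset from t
  nearestLeq? : (ℕ → Sym) → ℕ → ℕ → Bool
  nearestLeq? w t k = maybe′ (λ a → prefixMin (a ≤ᵇ_) (λ j → w (suc t + j)) k) false (w t)

  nearestLeq?-sound : ∀ {w} t k → T (nearestLeq? w t k) → NearestLeq w t (suc t + k)
  nearestLeq?-sound {w} t k h with w t in w[t] | w (suc t + k) in w[q]
  ... | nothing | _       = ⊥-elim h
  ... | just a  | nothing = ⊥-elim h
  ... | just a  | just c  =
    nearestLeq a c w[t] w[q] (≤ᵇ⇒≤ a c (proj₁ h′)) (s≤s (m≤m+n t k)) between
    where
    h′ : T (a ≤ᵇ c) × T (allAbove c (λ j → w (suc t + j)) k)
    h′ = Equivalence.to T-∧ h
    between : ∀ {r} → t < r → r < suc t + k → T (above c (w r))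
    between {r} t<r r<q with m≤n⇒∃[o]m+o≡n t<r
    ... | j , refl = allAbove-sound k (proj₂ h′) (+-cancelˡ-< (suc t) j k r<q)

  -- the position is given by its residue p modulo n instead, in the window (t, t + n]
  nearestLeqMod? : (ℕ → Sym) → ℕ → ℕ → ℕ → Bool
  nearestLeqMod? w n t p = nearestLeq? w t (cyclicOffset n (suc t) p)

  nearestLeqMod?-sound : ∀ {w n t} p → t < n → T (nearestLeqMod? w n t p) →
                         (p ≤ t × NearestLeq w t (n + p)) ⊎ (t < p × NearestLeq w t p)
  nearestLeqMod?-sound {w} {n} {t} p t<n h with p <? suc t
  ... | yes (s≤s p≤t) = inj₁ (p≤t , subst (NearestLeq w t) wraps (nearestLeq?-sound t _ h))
    where
    wraps : suc t + (n ∸ suc t + p) ≡ n + p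
    wraps = trans (sym (+-assoc (suc t) (n ∸ suc t) p)) (cong (λ x → x + p) (m+[n∸m]≡n t<n))
  ... | no p≮1+t = inj₂ (t<p , subst (NearestLeq w t) (m+[n∸m]≡n t<p) (nearestLeq?-sound t _ h))
    where
    t<p : t < p
    t<p = ≮⇒≥ p≮1+t

  nearestLeqMod?-unique : ∀ {w n} → (∀ r → w (n + r) ≡ w r) → ∀ p {t t′} →
                          t < t′ → t′ < n →
                          T (nearestLeqMod? w n t p) → T (nearestLeqMod? w n t′ p) → ⊥
  nearestLeqMod?-unique {n = n} periodic p {t} t<t′ t′<n h h′
    with nearestLeqMod?-sound p (<-trans t<t′ t′<n) h | nearestLeqMod?-sound p t′<n h′
  ... | inj₁ (_ , nl)  | inj₁ (_ , nl′)   = NearestLeq-unique nl nl′ t<t′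
  ... | inj₂ (_ , nl)  | inj₂ (_ , nl′)   = NearestLeq-unique nl nl′ t<t′
  ... | inj₂ (_ , nl)  | inj₁ (_ , nl′)   =
    NearestLeq-unique nl′ (NearestLeq-shift n periodic nl) (<-≤-trans t′<n (m≤m+n n t))
  ... | inj₁ (p≤t , _) | inj₂ (t′<p , _)  =
    <-irrefl refl (≤-<-trans p≤t (<-trans t<t′ t′<p))

  ∑-count-nearestLeq?-≤ : ∀ {w} n → (∀ r → w (n + r) ≡ w r) →
                          ∑[ t < n ] count n (nearestLeq? w t) ≤ n
  ∑-count-nearestLeq?-≤ {w} n periodic = begin
    ∑[ t < n ] count n (nearestLeq? w t)
      ≡⟨ ∑-cong n (λ {t} t<n → ∑-rotate (𝟙 ∘ nearestLeq? w t) t<n) ⟩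
    ∑[ t < n ] ∑[ p < n ] 𝟙 (nearestLeqMod? w n t p)
      ≡⟨ ∑-comm n n (λ t p → 𝟙 (nearestLeqMod? w n t p)) ⟩
    ∑[ p < n ] count n (λ t → nearestLeqMod? w n t p)
      ≤⟨ ∑-mono n (λ {p} _ → count-≤1 n (nearestLeqMod?-unique periodic p)) ⟩
    ∑[ p < n ] 1
      ≡⟨ ∑-1 n ⟩
    n ∎
    where open Data.Nat.Properties.≤-Reasoning

  -- RTS(V)[i] for V[i] = a, as rtsGo computes it (i is 1-based)
  rtsEntry : List Sym → ℕ → ℕ → ℤ
  rtsEntry V i a = (+ rankInf (PD (rotN i V)) (length V))
                 - (+ rankInf (drop 1 (PD (just a ∷ rotN i V))) (length V))

  length-pdGo : ∀ R Y → length (pdGo R Y) ≡ length Y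
  length-pdGo R []      = refl
  length-pdGo R (x ∷ Y) = cong suc (length-pdGo (x ∷ R) Y)

  +[m+n]-+m≡+n : ∀ m n → + (m + n) - + m ≡ + n
  +[m+n]-+m≡+n m n = begin
    + (m + n) - + m ≡⟨ ℤₚ.m-n≡m⊖n (m + n) m ⟩
    (m + n) ⊖ m     ≡⟨ ℤₚ.⊖-≥ (m≤m+n m n) ⟩
    + (m + n ∸ m)   ≡⟨ cong +_ (m+n∸m≡n m n) ⟩
    + n             ∎
    where open ≡-Reasoning

  rtsEntry-count : ∀ V i a →
    rtsEntry V i a ≡ + count (length V) (prefixMin (a ≤ᵇ_) (λ j → cyclic V (i + j)))
  rtsEntry-count V i a = begin
    + countInf (take n (PD Y)) - + countInf (take n (pdGo [ just a ] Y))
      ≡⟨ cong₂ (λ X X′ → + countInf X - + countInf X′)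
               (take-all-pdGo []) (take-all-pdGo [ just a ]) ⟩
    + countInf (PD Y) - + b
      ≡⟨ cong (λ m → + m - + b) (countInf-PD a Y n (≤-reflexive |Y|≡n)) ⟩
    + (b + count n atLeast) - + b
      ≡⟨ +[m+n]-+m≡+n b _ ⟩
    + count n atLeast
      ≡⟨ cong +_ (∑-cong n (λ k<n → cong 𝟙 (prefixMin-cong _ (Y[j] k<n)))) ⟩
    + count n (prefixMin (a ≤ᵇ_) (λ j → cyclic V (i + j))) ∎
    where
    open ≡-Reasoning
    n = length V
    Y = rotN i V
    b = countInf (pdGo [ just a ] Y)
    atLeast : ℕ → Bool
    atLeast = prefixMin (a ≤ᵇ_) (Y ‼_)
    |Y|≡n : length Y ≡ n
    |Y|≡n = length-rotN i V
    Y[j] : ∀ {j k} → k < n → j ≤ k → Y ‼ j ≡ cyclic V (i + j)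
    Y[j] k<n j≤k = rotN-‼ i (≤-<-trans j≤k k<n)
    take-all-pdGo : ∀ R → take n (pdGo R Y) ≡ pdGo R Y
    take-all-pdGo R = take-all n (pdGo R Y) (≤-reflexive (trans (length-pdGo R Y) |Y|≡n))

  rtsEntry-nearestLeq? : ∀ V {t a} → V ‼ t ≡ just a →
    rtsEntry V (suc t) a ≡ + count (length V) (nearestLeq? (cyclic V) t)
  rtsEntry-nearestLeq? V {t} {a} V[t] =
    trans (rtsEntry-count V (suc t) a) (cong +_ (∑-cong (length V) (λ {k} _ → cong 𝟙 (at k))))
    where
    w[t] : cyclic V t ≡ just a
    w[t] = trans (sym (rotN-‼ 0 (‼-just⇒< V V[t]))) V[t]
    ahead : ℕ → ℕ → Bool
    ahead b = prefixMin (b ≤ᵇ_) (λ j → cyclic V (suc t + j))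
    at : ∀ k → ahead a k ≡ nearestLeq? (cyclic V) t k
    at k = cong (maybe′ (λ b → ahead b k) false) (sym w[t])

  sumRTS-prefix-≤ : ∀ {V} i L (e : ℕ → ℕ) →
    (∀ {k a} → L ‼ k ≡ just a → rtsEntry V (i + k) a ≡ + e k) →
    sumRTS (take (dollarPrefixLen L) (rtsGo V i L)) ℤ.≤ + ∑ (length L) e
  sumRTS-prefix-≤ i []            e _ = +≤+ z≤n
  sumRTS-prefix-≤ i (nothing ∷ L) e _ = +≤+ z≤n
  sumRTS-prefix-≤ {V} i (just a ∷ L) e entry = begin
    rtsEntry V i a ℤ.+ sumRTS (take (dollarPrefixLen L) (rtsGo V (suc i) L))
      ≤⟨ ℤₚ.+-mono-≤ (ℤₚ.≤-reflexive here)
                     (sumRTS-prefix-≤ (suc i) L (e ∘ suc) later) ⟩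
    + e 0 ℤ.+ + ∑[ k < length L ] e (suc k)
      ≡⟨ sym (ℤₚ.pos-+ (e 0) _) ⟩
    + ∑ (suc (length L)) e ∎
    where
    open ℤₚ.≤-Reasoning
    here : rtsEntry V i a ≡ + e 0
    here = subst (λ j → rtsEntry V j a ≡ + e 0) (+-identityʳ i) (entry refl)
    later : ∀ {k b} → L ‼ k ≡ just b → rtsEntry V (suc i + k) b ≡ + e (suc k)
    later {k} {b} L[k] = subst (λ j → rtsEntry V j b ≡ + e (suc k)) (+-suc i k) (entry L[k])

open RTSBound
open import Data.Integer using (+_; _≤_)
open import Data.Integer using (+≤+)
open import Data.Integer.Properties using (≤-trans)

lemma8 : (σ : ℕ) (V : List Sym) → V ≢ [] → All (InAlphabet σ) V →
    sumRTS (take (dollarPrefixLen V) (RTS V)) ≤ + length V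
lemma8 _ V _ _ = ≤-trans
  (sumRTS-prefix-≤ 1 V (λ t → count n (nearestLeq? (cyclic V) t)) (rtsEntry-nearestLeq? V))
  (+≤+ (∑-count-nearestLeq?-≤ n (cyclic-periodic V)))
  where
  n : ℕ
  n = length V
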